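{- Let $G=(V,E)$ be a connected graph and let $\mathcal{C}$ be an even generating set for $\mathcal{F}(G)$. Then for every positive integer $q$, the vectors $\chi_C \bmod q$, $C\in\mathcal{C}$, generate the $\mathbb{Z}_q$-module $\mathcal{F}_q(G)$ of $\mathbb{Z}_q$-flows on $G$.
   Context: Graphs are finite multigraphs with a fixed orientation. $\mathcal{F}(G)$ is the $\mathbb{Z}$-module of $\mathbb{Z}$-flows $f:E\to\mathbb{Z}$ (inflow equals outflow at every vertex); $\mathcal{F}_q(G)$ is the $\mathbb{Z}_q$-module of maps $f:E\to\mathbb{Z}_q$ with the same conservation property in $\mathbb{Z}_q$. For an even subgraph $C$ (all degrees even), choose an Eulerian orientation of each component of $C$ and set $\chi_C(e)=0$ for $e\notin C$ and $\chi_C(e)=\pm1$ for $e\in C$ according to whether the orientations in $C$ and $G$ agree. An even generating set for $\mathcal{F}(G)$ is a set $\mathcal{C}$ of even subgraphs such that $\{\chi_C:C\in\mathcal{C}\}$ generates $\mathcal{F}(G)$ as a $\mathbb{Z}$-module. -}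

module Defs where

open import Data.Nat as ℕ using (ℕ; zero; suc; NonZero)
open import Data.Fin using (Fin; zero; suc; toℕ)
open import Data.Fin.Properties using (_≟_)
open import Data.Bool using (Bool; true; false; if_then_else_)
open import Data.Integer as ℤ using (ℤ; +_; -_)
open import Data.Integer.Divisibility using (_∣_)
open import Data.Product using (Σ; ∃; _×_; _,_)
open import Relation.Nullary.Decidable using (does)
open import Relation.Binary.PropositionalEquality using (_≡_)

-- A finite oriented multigraph: vertices Fin n, edges Fin m,
-- edge e is oriented from src e to tgt e (loops allowed).
record Graph : Set where
  field
    n   : ℕ
    m   : ℕ
    src : Fin m → Fin n
    tgt : Fin m → Fin n
open Graph public

sumℤ : ∀ {k} → (Fin k → ℤ) → ℤ
sumℤ {zero}  f = + 0
sumℤ {suc k} f = f zero ℤ.+ sumℤ (λ i → f (suc i))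

sumℕ : ∀ {k} → (Fin k → ℕ) → ℕ
sumℕ {zero}  f = 0
sumℕ {suc k} f = f zero ℕ.+ sumℕ (λ i → f (suc i))

[_≡ᵛ_] : ∀ {n} → Fin n → Fin n → ℕ
[ u ≡ᵛ v ] = if does (u ≟ v) then 1 else 0

data Reachable (G : Graph) : Fin (n G) → Fin (n G) → Set where
  here : ∀ {v} → Reachable G v v
  fwd  : ∀ {u} e → Reachable G (tgt G e) u → Reachable G (src G e) u
  bwd  : ∀ {u} e → Reachable G (src G e) u → Reachable G (tgt G e) u

Connected : Graph → Set
Connected G = ∀ u v → Reachable G u v

inflow : (G : Graph) → (Fin (m G) → ℤ) → Fin (n G) → ℤ
inflow G f v = sumℤ (λ e → + [ tgt G e ≡ᵛ v ] ℤ.* f e)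

outflow : (G : Graph) → (Fin (m G) → ℤ) → Fin (n G) → ℤ
outflow G f v = sumℤ (λ e → + [ src G e ≡ᵛ v ] ℤ.* f e)

IsZFlow : (G : Graph) → (Fin (m G) → ℤ) → Set
IsZFlow G f = ∀ v → inflow G f v ≡ outflow G f v

_≡_[mod_] : ℤ → ℤ → ℕ → Set
a ≡ b [mod q ] = (+ q) ∣ (a ℤ.- b)

-- ℤ_q is represented by Fin q (residues 0..q-1); the lift to ℤ
toℤ : ∀ {q} → Fin q → ℤ
toℤ i = + toℕ i

IsZqFlow : (G : Graph) (q : ℕ) → (Fin (m G) → Fin q) → Set
IsZqFlow G q f =
  ∀ v → inflow G (λ e → toℤ (f e)) v ≡ outflow G (λ e → toℤ (f e)) v [mod q ]

-- Even subgraphs (spanning, given by their edge set) and degrees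
-- (a loop contributes 2 to the degree of its vertex)
degIn : (G : Graph) → (Fin (m G) → Bool) → Fin (n G) → ℕ
degIn G C v = sumℕ (λ e → if C e then [ src G e ≡ᵛ v ] ℕ.+ [ tgt G e ≡ᵛ v ] else 0)

IsEven : (G : Graph) → (Fin (m G) → Bool) → Set
IsEven G C = ∀ v → ∃ λ k → degIn G C v ≡ 2 ℕ.* k

-- An orientation of C, given relative to G: o e = true means the
-- orientation of e in C agrees with that in G (only relevant for e ∈ C).
head tail : (G : Graph) → (Fin (m G) → Bool) → Fin (m G) → Fin (n G)
head G o e = if o e then tgt G e else src G e
tail G o e = if o e then src G e else tgt G e

indegC outdegC : (G : Graph) → (C o : Fin (m G) → Bool) → Fin (n G) → ℕ
indegC  G C o v = sumℕ (λ e → if C e then [ head G o e ≡ᵛ v ] else 0)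
outdegC G C o v = sumℕ (λ e → if C e then [ tail G o e ≡ᵛ v ] else 0)

IsEulerianOrientation : (G : Graph) → (C o : Fin (m G) → Bool) → Set
IsEulerianOrientation G C o = ∀ v → indegC G C o v ≡ outdegC G C o v

record OrientedEvenSubgraph (G : Graph) : Set where
  field
    edges  : Fin (m G) → Bool
    even   : IsEven G edges
    orient : Fin (m G) → Bool
    euler  : IsEulerianOrientation G edges orient
open OrientedEvenSubgraph public

χ : {G : Graph} → OrientedEvenSubgraph G → Fin (m G) → ℤ
χ C e = if edges C e then (if orient C e then + 1 else - (+ 1)) else + 0

IsEvenGeneratingSet : (G : Graph) {k : ℕ} → (Fin k → OrientedEvenSubgraph G) → Set
IsEvenGeneratingSet G {k} 𝓒 =
  ∀ (f : Fin (m G) → ℤ) → IsZFlow G f →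
    Σ (Fin k → ℤ) λ c → ∀ e → f e ≡ sumℤ (λ i → c i ℤ.* χ (𝓒 i) e)

GeneratesZqFlows : (G : Graph) (q : ℕ) {k : ℕ} → (Fin k → OrientedEvenSubgraph G) → Set
GeneratesZqFlows G q {k} 𝓒 =
  ∀ (f : Fin (m G) → Fin q) → IsZqFlow G q f →
    Σ (Fin k → Fin q) λ c →
      ∀ e → toℤ (f e) ≡ sumℤ (λ i → toℤ (c i) ℤ.* χ (𝓒 i) e) [mod q ]

{-# OPTIONS --safe #-}
module Submission where

-- Read a ℤ_q-flow f as an integer function F with values in [0, q).  Its boundary
-- ∂F (inflow minus outflow) is divisible by q at every vertex and sums to zero over
-- all vertices, so ∂F / q also sums to zero.  In a connected graph every integer
-- vertex function d of total sum zero is a boundary: with a root r, d = ∑ᵤ d(u)(δᵤ − δᵣ),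
-- and δᵤ − δᵣ is the boundary of a path from r to u.  Hence ∂F = q ∂h for an integer h,
-- F − q h is a ℤ-flow, and reducing the coefficients of its expansion ∑ c_C χ_C modulo q
-- expresses f.

open import Defs
open import Data.Nat using (ℕ; _≥_; zero; suc; NonZero)
open import Data.Fin using (Fin; zero; suc; fromℕ<)
open import Data.Fin.Properties using (toℕ-fromℕ<; ¬Fin0)
open import Data.Integer using (ℤ; +_; 0ℤ; 1ℤ; -1ℤ; -_; _+_; _*_; _-_)
open import Data.Integer.Properties
  using ( +-*-semiring; +-identityˡ; +-identityʳ; +-inverseʳ; *-comm; *-zeroˡ; *-zeroʳ
        ; *-identityˡ; *-identityʳ; *-distribˡ-+; neg-distribˡ-*; i-j≡0⇒i≡j; *-cancelʳ-≡)
open import Data.Integer.DivMod using (_%ℕ_; _/ℕ_; n%ℕd<d; a≡a%ℕn+[a/ℕn]*n)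
open import Data.Integer.Divisibility.Signed
  using (_∣_; divides; quotient; ∣ᵤ⇒∣; ∣⇒∣ᵤ; ∣-refl; ∣m∣n⇒∣m+n; ∣m⇒∣m*n; ∣n⇒∣m*n)
open import Data.Integer.Tactic.RingSolver using (solve-∀)
open import Algebra.Properties.Semiring.Sum +-*-semiring
  using (sum; ∑-distrib-+; ∑-comm; *-distribˡ-sum; *-distribʳ-sum; sum-replicate-zero)
open import Data.Product using (Σ; _,_; proj₁; proj₂)
open import Function using (_∘_)
open import Relation.Nullary using (Dec; yes; no; contradiction)
open import Relation.Binary.PropositionalEquality
open ≡-Reasoning

δ : ∀ {k} → Fin k → Fin k → ℤ
δ u v = + [ u ≡ᵛ v ]

δ-sym : ∀ {k} (u v : Fin k) → δ u v ≡ δ v u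
δ-sym zero    zero    = refl
δ-sym zero    (suc v) = refl
δ-sym (suc u) zero    = refl
δ-sym (suc u) (suc v) = δ-sym u v

sumℤ≡sum : ∀ {k} (f : Fin k → ℤ) → sumℤ f ≡ sum f
sumℤ≡sum {zero}  f = refl
sumℤ≡sum {suc k} f = cong (_+_ (f zero)) (sumℤ≡sum (f ∘ suc))

sumℤ-cong : ∀ {k} {f g : Fin k → ℤ} → f ≗ g → sumℤ f ≡ sumℤ g
sumℤ-cong {zero}  f≗g = refl
sumℤ-cong {suc k} f≗g = cong₂ _+_ (f≗g zero) (sumℤ-cong (f≗g ∘ suc))

sumℤ-zero : ∀ k → sumℤ {k} (λ _ → 0ℤ) ≡ 0ℤ
sumℤ-zero k = trans (sumℤ≡sum {k} (λ _ → 0ℤ)) (sum-replicate-zero k)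

sumℤ-distrib-+ : ∀ {k} (f g : Fin k → ℤ) → sumℤ (λ i → f i + g i) ≡ sumℤ f + sumℤ g
sumℤ-distrib-+ f g = begin
  sumℤ (λ i → f i + g i) ≡⟨ sumℤ≡sum (λ i → f i + g i) ⟩
  sum (λ i → f i + g i)  ≡⟨ ∑-distrib-+ f g ⟩
  sum f + sum g          ≡⟨ cong₂ _+_ (sumℤ≡sum f) (sumℤ≡sum g) ⟨
  sumℤ f + sumℤ g        ∎

*-distribˡ-sumℤ : ∀ {k} c (f : Fin k → ℤ) → c * sumℤ f ≡ sumℤ (λ i → c * f i)
*-distribˡ-sumℤ c f = begin
  c * sumℤ f             ≡⟨ cong (c *_) (sumℤ≡sum f) ⟩
  c * sum f              ≡⟨ *-distribˡ-sum c f ⟩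
  sum (λ i → c * f i)    ≡⟨ sumℤ≡sum (λ i → c * f i) ⟨
  sumℤ (λ i → c * f i)   ∎

*-distribʳ-sumℤ : ∀ {k} c (f : Fin k → ℤ) → sumℤ f * c ≡ sumℤ (λ i → f i * c)
*-distribʳ-sumℤ c f = begin
  sumℤ f * c             ≡⟨ cong (_* c) (sumℤ≡sum f) ⟩
  sum f * c              ≡⟨ *-distribʳ-sum c f ⟩
  sum (λ i → f i * c)    ≡⟨ sumℤ≡sum (λ i → f i * c) ⟨
  sumℤ (λ i → f i * c)   ∎

sumℤ-comm : ∀ {k l} (f : Fin k → Fin l → ℤ) →
            sumℤ (λ i → sumℤ (f i)) ≡ sumℤ (λ j → sumℤ (λ i → f i j))
sumℤ-comm f = begin
  sumℤ (λ i → sumℤ (f i))              ≡⟨ sumℤ-cong (λ i → sumℤ≡sum (f i)) ⟩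
  sumℤ (λ i → sum (f i))               ≡⟨ sumℤ≡sum (λ i → sum (f i)) ⟩
  sum (λ i → sum (f i))                ≡⟨ ∑-comm f ⟩
  sum (λ j → sum (λ i → f i j))        ≡⟨ sumℤ≡sum (λ j → sum (λ i → f i j)) ⟨
  sumℤ (λ j → sum (λ i → f i j))       ≡⟨ sumℤ-cong (λ j → sumℤ≡sum (λ i → f i j)) ⟨
  sumℤ (λ j → sumℤ (λ i → f i j))      ∎

sumℤ-select : ∀ {k} (i : Fin k) (f : Fin k → ℤ) → sumℤ (λ j → δ i j * f j) ≡ f i
sumℤ-select {suc k} zero f = begin
  1ℤ * f zero + sumℤ (λ j → 0ℤ * f (suc j))
    ≡⟨ cong₂ _+_ (*-identityˡ (f zero)) (sumℤ-cong (*-zeroˡ ∘ f ∘ suc)) ⟩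
  f zero + sumℤ {k} (λ _ → 0ℤ)              ≡⟨ cong (_+_ (f zero)) (sumℤ-zero k) ⟩
  f zero + 0ℤ                               ≡⟨ +-identityʳ (f zero) ⟩
  f zero                                    ∎
sumℤ-select {suc k} (suc i) f = begin
  0ℤ * f zero + sumℤ (λ j → δ i j * f (suc j))
    ≡⟨ cong (_+ sumℤ (λ j → δ i j * f (suc j))) (*-zeroˡ (f zero)) ⟩
  0ℤ + sumℤ (λ j → δ i j * f (suc j))          ≡⟨ +-identityˡ _ ⟩
  sumℤ (λ j → δ i j * f (suc j))               ≡⟨ sumℤ-select i (f ∘ suc) ⟩
  f (suc i)                                    ∎

sumℤ-δ : ∀ {k} (i : Fin k) → sumℤ (δ i) ≡ 1ℤ
sumℤ-δ i = trans (sumℤ-cong (λ j → sym (*-identityʳ (δ i j)))) (sumℤ-select i (λ _ → 1ℤ))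

sumℤ-distrib-- : ∀ {k} (f g : Fin k → ℤ) → sumℤ (λ i → f i - g i) ≡ sumℤ f - sumℤ g
sumℤ-distrib-- {zero}  f g = refl
sumℤ-distrib-- {suc k} f g =
  trans (cong (_+_ (f zero - g zero)) (sumℤ-distrib-- (f ∘ suc) (g ∘ suc)))
        (interchange (f zero) (g zero) (sumℤ (f ∘ suc)) (sumℤ (g ∘ suc)))
  where
  interchange : ∀ a b c d → a - b + (c - d) ≡ a + c - (b + d)
  interchange = solve-∀

∣-sumℤ : ∀ {k d} (f : Fin k → ℤ) → (∀ i → d ∣ f i) → d ∣ sumℤ f
∣-sumℤ {zero} {d} f d∣f = divides 0ℤ (sym (*-zeroˡ d))
∣-sumℤ {suc k}    f d∣f = ∣m∣n⇒∣m+n (d∣f zero) (∣-sumℤ (f ∘ suc) (d∣f ∘ suc))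

sumℤ-*-distrib-+ : ∀ {k} (a f g : Fin k → ℤ) →
                   sumℤ (λ i → a i * (f i + g i)) ≡ sumℤ (λ i → a i * f i) + sumℤ (λ i → a i * g i)
sumℤ-*-distrib-+ a f g =
  trans (sumℤ-cong (λ i → *-distribˡ-+ (a i) (f i) (g i))) (sumℤ-distrib-+ (λ i → a i * f i) (λ i → a i * g i))

sumℤ-*-scale : ∀ {k} (a : Fin k → ℤ) c (f : Fin k → ℤ) →
               sumℤ (λ i → a i * (c * f i)) ≡ c * sumℤ (λ i → a i * f i)
sumℤ-*-scale a c f =
  trans (sumℤ-cong (λ i → swap (a i) c (f i))) (sym (*-distribˡ-sumℤ c (λ i → a i * f i)))
  where
  swap : ∀ x y z → x * (y * z) ≡ y * (x * z)
  swap = solve-∀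

residue : ∀ q .{{_ : NonZero q}} → ℤ → Fin q
residue q c = fromℕ< (n%ℕd<d c q)

∣-sub-residue : ∀ q .{{_ : NonZero q}} c → + q ∣ c - toℤ (residue q c)
∣-sub-residue q c = divides (c /ℕ q) (begin
  c - toℤ (residue q c)                    ≡⟨ cong (λ r → c - + r) (toℕ-fromℕ< (n%ℕd<d c q)) ⟩
  c - + (c %ℕ q)                           ≡⟨ cong (λ x → x - + (c %ℕ q)) (a≡a%ℕn+[a/ℕn]*n c q) ⟩
  + (c %ℕ q) + (c /ℕ q) * + q - + (c %ℕ q) ≡⟨ cancel (+ (c %ℕ q)) ((c /ℕ q) * + q) ⟩
  (c /ℕ q) * + q                           ∎)
  where
  cancel : ∀ r t → r + t - r ≡ t
  cancel = solve-∀

∣-sumℤ-sub-residues : ∀ {k} q .{{_ : NonZero q}} (c x : Fin k → ℤ) →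
                      + q ∣ sumℤ (λ i → c i * x i) - sumℤ (λ i → toℤ (residue q (c i)) * x i)
∣-sumℤ-sub-residues q c x =
  subst (+ q ∣_) (sumℤ-distrib-- (λ i → c i * x i) (λ i → toℤ (residue q (c i)) * x i))
        (∣-sumℤ _ λ i → subst (+ q ∣_) (factor (c i) (toℤ (residue q (c i))) (x i))
                                       (∣m⇒∣m*n (x i) (∣-sub-residue q (c i))))
  where
  factor : ∀ a b y → (a - b) * y ≡ a * y - b * y
  factor = solve-∀

Fin-inhabited? : ∀ k → Dec (Fin k)
Fin-inhabited? zero    = no ¬Fin0
Fin-inhabited? (suc k) = yes zero

module _ (G : Graph) where

  ∂ : (Fin (m G) → ℤ) → Fin (n G) → ℤ
  ∂ g v = inflow G g v - outflow G g v

  ∂≡0⇒IsZFlow : ∀ {g} → (∀ v → ∂ g v ≡ 0ℤ) → IsZFlow G g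
  ∂≡0⇒IsZFlow ∂g≡0 v = i-j≡0⇒i≡j _ _ (∂g≡0 v)

  ∂-cong : ∀ {g h} → g ≗ h → ∀ v → ∂ g v ≡ ∂ h v
  ∂-cong g≗h v = cong₂ _-_ (sumℤ-cong (λ e → cong (δ (tgt G e) v *_) (g≗h e)))
                           (sumℤ-cong (λ e → cong (δ (src G e) v *_) (g≗h e)))

  ∂-zero : ∀ v → ∂ (λ _ → 0ℤ) v ≡ 0ℤ
  ∂-zero v = cong₂ _-_ (vanish (tgt G)) (vanish (src G))
    where
    vanish : (end : Fin (m G) → Fin (n G)) → sumℤ (λ e → δ (end e) v * 0ℤ) ≡ 0ℤ
    vanish end = trans (sumℤ-cong (λ e → *-zeroʳ (δ (end e) v))) (sumℤ-zero (m G))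

  ∂-+ : ∀ g h v → ∂ (λ e → g e + h e) v ≡ ∂ g v + ∂ h v
  ∂-+ g h v = trans (cong₂ _-_ (sumℤ-*-distrib-+ (λ e → δ (tgt G e) v) g h)
                               (sumℤ-*-distrib-+ (λ e → δ (src G e) v) g h))
                    (interchange (inflow G g v) (inflow G h v) (outflow G g v) (outflow G h v))
    where
    interchange : ∀ a b c d → a + b - (c + d) ≡ a - c + (b - d)
    interchange = solve-∀

  ∂-* : ∀ c g v → ∂ (λ e → c * g e) v ≡ c * ∂ g v
  ∂-* c g v = trans (cong₂ _-_ (sumℤ-*-scale (λ e → δ (tgt G e) v) c g)
                               (sumℤ-*-scale (λ e → δ (src G e) v) c g))
                    (distrib c (inflow G g v) (outflow G g v))
    where
    distrib : ∀ a b c → a * b - a * c ≡ a * (b - c)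
    distrib = solve-∀

  ∂-δ : ∀ e v → ∂ (δ e) v ≡ δ (tgt G e) v - δ (src G e) v
  ∂-δ e v = cong₂ _-_ (endpoint (tgt G)) (endpoint (src G))
    where
    endpoint : (end : Fin (m G) → Fin (n G)) → sumℤ (λ e′ → δ (end e′) v * δ e e′) ≡ δ (end e) v
    endpoint end = trans (sumℤ-cong (λ e′ → *-comm (δ (end e′) v) (δ e e′)))
                         (sumℤ-select e (λ e′ → δ (end e′) v))

  sumℤ-∂ : ∀ g → sumℤ (∂ g) ≡ 0ℤ
  sumℤ-∂ g = begin
    sumℤ (∂ g)                             ≡⟨ sumℤ-distrib-- (inflow G g) (outflow G g) ⟩
    sumℤ (inflow G g) - sumℤ (outflow G g) ≡⟨ cong₂ _-_ (total (tgt G)) (total (src G)) ⟩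
    sumℤ g - sumℤ g                        ≡⟨ +-inverseʳ (sumℤ g) ⟩
    0ℤ                                     ∎
    where
    total : (end : Fin (m G) → Fin (n G)) → sumℤ (λ v → sumℤ (λ e → δ (end e) v * g e)) ≡ sumℤ g
    total end = begin
      sumℤ (λ v → sumℤ (λ e → δ (end e) v * g e)) ≡⟨ sumℤ-comm (λ v e → δ (end e) v * g e) ⟩
      sumℤ (λ e → sumℤ (λ v → δ (end e) v * g e)) ≡⟨ sumℤ-cong (λ e → *-distribʳ-sumℤ (g e) (δ (end e))) ⟨
      sumℤ (λ e → sumℤ (δ (end e)) * g e)         ≡⟨ sumℤ-cong (λ e → cong (_* g e) (sumℤ-δ (end e))) ⟩
      sumℤ (λ e → 1ℤ * g e)                       ≡⟨ sumℤ-cong (λ e → *-identityˡ (g e)) ⟩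
      sumℤ g                                      ∎

  IsBoundary : (Fin (n G) → ℤ) → Set
  IsBoundary d = Σ (Fin (m G) → ℤ) λ h → ∀ v → ∂ h v ≡ d v

  isBoundary-resp : ∀ {d d′} → d ≗ d′ → IsBoundary d → IsBoundary d′
  isBoundary-resp d≗d′ (h , ∂h≡d) = h , λ v → trans (∂h≡d v) (d≗d′ v)

  isBoundary-zero : IsBoundary (λ _ → 0ℤ)
  isBoundary-zero = (λ _ → 0ℤ) , ∂-zero

  isBoundary-+ : ∀ {d d′} → IsBoundary d → IsBoundary d′ → IsBoundary (λ v → d v + d′ v)
  isBoundary-+ (h , ∂h≡d) (h′ , ∂h′≡d′) =
    (λ e → h e + h′ e) , λ v → trans (∂-+ h h′ v) (cong₂ _+_ (∂h≡d v) (∂h′≡d′ v))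

  isBoundary-* : ∀ c {d} → IsBoundary d → IsBoundary (λ v → c * d v)
  isBoundary-* c (h , ∂h≡d) = (λ e → c * h e) , λ v → trans (∂-* c h v) (cong (c *_) (∂h≡d v))

  isBoundary-sum : ∀ {k} {d : Fin k → Fin (n G) → ℤ} →
                   (∀ i → IsBoundary (d i)) → IsBoundary (λ v → sumℤ (λ i → d i v))
  isBoundary-sum {zero}  bd = isBoundary-zero
  isBoundary-sum {suc k} bd = isBoundary-+ (bd zero) (isBoundary-sum (bd ∘ suc))

  isBoundary-edge : ∀ e → IsBoundary (λ v → δ (tgt G e) v - δ (src G e) v)
  isBoundary-edge e = δ e , ∂-δ e

  isBoundary-path : ∀ {a b} → Reachable G a b → IsBoundary (λ v → δ b v - δ a v)
  isBoundary-path {a} here = isBoundary-resp (λ v → sym (+-inverseʳ (δ a v))) isBoundary-zero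
  isBoundary-path {b = b} (fwd e r) =
    isBoundary-resp (λ v → concat (δ b v) (δ (tgt G e) v) (δ (src G e) v))
                    (isBoundary-+ (isBoundary-path r) (isBoundary-edge e))
    where
    concat : ∀ x y z → x - y + (y - z) ≡ x - z
    concat = solve-∀
  isBoundary-path {b = b} (bwd e r) =
    isBoundary-resp (λ v → concat (δ b v) (δ (tgt G e) v) (δ (src G e) v))
                    (isBoundary-+ (isBoundary-path r) (isBoundary-* -1ℤ (isBoundary-edge e)))
    where
    concat : ∀ x y z → x - z + -1ℤ * (y - z) ≡ x - y
    concat = solve-∀

  isBoundary-zeroSum : Connected G → ∀ {d} → sumℤ d ≡ 0ℤ → IsBoundary d
  isBoundary-zeroSum conn {d} Σd≡0 with Fin-inhabited? (n G)
  ... | no  empty = (λ _ → 0ℤ) , λ v → contradiction v empty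
  ... | yes r     = isBoundary-resp recombine
                      (isBoundary-sum (λ u → isBoundary-* (d u) (isBoundary-path (conn r u))))
    where
    expand : ∀ a b c → a * (b - c) ≡ b * a - c * a
    expand = solve-∀
    drop-zero : ∀ a b → a - b * 0ℤ ≡ a
    drop-zero = solve-∀
    recombine : ∀ v → sumℤ (λ u → d u * (δ u v - δ r v)) ≡ d v
    recombine v = begin
      sumℤ (λ u → d u * (δ u v - δ r v))
        ≡⟨ sumℤ-cong (λ u → trans (expand (d u) (δ u v) (δ r v))
                                  (cong (λ x → x * d u - δ r v * d u) (δ-sym u v))) ⟩
      sumℤ (λ u → δ v u * d u - δ r v * d u)
        ≡⟨ sumℤ-distrib-- (λ u → δ v u * d u) (λ u → δ r v * d u) ⟩
      sumℤ (λ u → δ v u * d u) - sumℤ (λ u → δ r v * d u)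
        ≡⟨ cong₂ _-_ (sumℤ-select v d) (sym (*-distribˡ-sumℤ (δ r v) d)) ⟩
      d v - δ r v * sumℤ d
        ≡⟨ cong (λ s → d v - δ r v * s) Σd≡0 ⟩
      d v - δ r v * 0ℤ
        ≡⟨ drop-zero (d v) (δ r v) ⟩
      d v ∎

  lift-to-ZFlow : Connected G → ∀ q .{{_ : NonZero q}} (F : Fin (m G) → ℤ) → (∀ v → + q ∣ ∂ F v) →
                  Σ (Fin (m G) → ℤ) λ h → IsZFlow G (λ e → F e - + q * h e)
  lift-to-ZFlow conn q F q∣∂F = h , ∂≡0⇒IsZFlow conserved
    where
    k : Fin (n G) → ℤ
    k v = quotient (q∣∂F v)
    ∂F≡kq : ∀ v → ∂ F v ≡ k v * + q
    ∂F≡kq v = _∣_.equality (q∣∂F v)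
    Σk≡0 : sumℤ k ≡ 0ℤ
    Σk≡0 = *-cancelʳ-≡ (sumℤ k) 0ℤ (+ q) (begin
      sumℤ k * + q              ≡⟨ *-distribʳ-sumℤ (+ q) k ⟩
      sumℤ (λ v → k v * + q)    ≡⟨ sumℤ-cong ∂F≡kq ⟨
      sumℤ (∂ F)                ≡⟨ sumℤ-∂ F ⟩
      0ℤ                        ≡⟨ *-zeroˡ (+ q) ⟨
      0ℤ * + q                  ∎)
    boundary : IsBoundary k
    boundary = isBoundary-zeroSum conn Σk≡0
    h : Fin (m G) → ℤ
    h = proj₁ boundary
    cancel : ∀ a b → a * b + - b * a ≡ 0ℤ
    cancel = solve-∀
    conserved : ∀ v → ∂ (λ e → F e - + q * h e) v ≡ 0ℤ
    conserved v = begin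
      ∂ (λ e → F e - + q * h e) v      ≡⟨ ∂-cong (λ e → cong (_+_ (F e)) (neg-distribˡ-* (+ q) (h e))) v ⟩
      ∂ (λ e → F e + - + q * h e) v    ≡⟨ ∂-+ F (λ e → - + q * h e) v ⟩
      ∂ F v + ∂ (λ e → - + q * h e) v  ≡⟨ cong (_+_ (∂ F v)) (∂-* (- + q) h v) ⟩
      ∂ F v + - + q * ∂ h v            ≡⟨ cong₂ (λ x y → x + - + q * y) (∂F≡kq v) (proj₂ boundary v) ⟩
      k v * + q + - + q * k v          ≡⟨ cancel (k v) (+ q) ⟩
      0ℤ                               ∎

lemma2p4 : (G : Graph) → Connected G →
           {k : ℕ} (𝓒 : Fin k → OrientedEvenSubgraph G) →
           IsEvenGeneratingSet G 𝓒 →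
           (q : ℕ) → q ≥ 1 → GeneratesZqFlows G q 𝓒
lemma2p4 G conn {k} 𝓒 gen q@(suc _) _ f isZqFlow = residue q ∘ c , congruent
  where
  F : Fin (m G) → ℤ
  F e = toℤ (f e)
  lifted : Σ (Fin (m G) → ℤ) λ h → IsZFlow G (λ e → F e - + q * h e)
  lifted = lift-to-ZFlow G conn q F (λ v → ∣ᵤ⇒∣ (isZqFlow v))
  h : Fin (m G) → ℤ
  h = proj₁ lifted
  decomposition : Σ (Fin k → ℤ) λ c → ∀ e → F e - + q * h e ≡ sumℤ (λ i → c i * χ (𝓒 i) e)
  decomposition = gen (λ e → F e - + q * h e) (proj₂ lifted)
  c : Fin k → ℤ
  c = proj₁ decomposition
  absorb : ∀ a b r t → a - b * t - r + t * b ≡ a - r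
  absorb = solve-∀
  congruent : ∀ e → F e ≡ sumℤ (λ i → toℤ (residue q (c i)) * χ (𝓒 i) e) [mod q ]
  congruent e = ∣⇒∣ᵤ (subst (+ q ∣_) rearranged
                        (∣m∣n⇒∣m+n (∣-sumℤ-sub-residues q c χₑ) (∣n⇒∣m*n (h e) ∣-refl)))
    where
    χₑ : Fin k → ℤ
    χₑ i = χ (𝓒 i) e
    R : ℤ
    R = sumℤ (λ i → toℤ (residue q (c i)) * χₑ i)
    rearranged : sumℤ (λ i → c i * χₑ i) - R + h e * + q ≡ F e - R
    rearranged = trans (cong (λ s → s - R + h e * + q) (sym (proj₂ decomposition e)))
                       (absorb (F e) (+ q) R (h e))
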